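{- For every integer $n\ge 3$, let $C_n$ be the cycle on $n$ vertices and $P_{n-1}$ the path on $n-1$ vertices. Then \[ \mathcal{L}(C_n)=\frac{\mathcal{L}(P_{n-1})}{n\binom{n-1}{2}}. \]
   Context: Random graph process ("construction"): start with $G_1$, the graph with the single vertex $1$ and no edges. For $t\ge 2$, the graph $G_t$ on vertex set $\{1,\dots,t\}$ is obtained from $G_{t-1}$ (on vertex set $\{1,\dots,t-1\}$) as follows, independently of all earlier choices: choose an integer $k\in\{0,1,\dots,t-1\}$ uniformly at random; then choose a $k$-element subset $S\subseteq\{1,\dots,t-1\}$ uniformly at random among all $\binom{t-1}{k}$ such subsets; then add the new vertex $t$ and the edges $\{s,t\}$ for all $s\in S$. For a finite simple graph $G$ on $t$ vertices, its (graph) likelihood is $\mathcal{L}(G):=\Pr[G_t\cong G]$. -}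

module Defs where

open import Data.Nat using (ℕ; zero; suc; _*_; _≡ᵇ_)
open import Data.Nat.Combinatorics using (_C_)
open import Data.Bool using (Bool; true; false; _∨_; _∧_; if_then_else_)
open import Data.Fin using (Fin; zero; suc; toℕ)
open import Data.Fin.Subset using (Subset; ∣_∣)
open import Data.Fin.Permutation using (Permutation′; _⟨$⟩ʳ_)
open import Data.Vec using (Vec; []; _∷_; lookup)
open import Data.List using (List; []; _∷_; map; foldr; concatMap)
open import Data.Product using (_×_; _,_; ∃)
open import Data.Unit using (⊤; tt)
open import Data.Integer using (+_)
open import Data.Rational using (ℚ; 0ℚ; 1ℚ; _+_; _/_)
import Data.Rational as Q
open import Relation.Binary.PropositionalEquality using (_≡_)
open import Relation.Nullary using (Dec; does)

record Graph (n : ℕ) : Set where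
  constructor mkGraph
  field
    adj : Fin n → Fin n → Bool
open Graph public

_≅_ : ∀ {n} → Graph n → Graph n → Set
_≅_ {n} G H = ∃ λ (σ : Permutation′ n) →
  ∀ i j → adj G (σ ⟨$⟩ʳ i) (σ ⟨$⟩ʳ j) ≡ adj H i j

-- A decision procedure for isomorphism (its boolean answer is uniquely
-- determined, so the likelihood below does not depend on the choice).
IsoDec : Set
IsoDec = ∀ {n} (G H : Graph n) → Dec (G ≅ H)

-- 1/d as a rational, with the (never used) convention 1/0 = 0.
recipℕ : ℕ → ℚ
recipℕ zero = 0ℚ
recipℕ (suc d) = (+ 1) / suc d

-- Histories of the process up to n vertices: at each step the new vertex
-- chooses the set S of earlier vertices it is joined to.
Hist : ℕ → Set
Hist zero = ⊤
Hist (suc n) = Hist n × Subset n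

allSubsets : ∀ m → List (Subset m)
allSubsets zero = [] ∷ []
allSubsets (suc m) = concatMap (λ s → (true ∷ s) ∷ (false ∷ s) ∷ []) (allSubsets m)

allHist : ∀ n → List (Hist n)
allHist zero = tt ∷ []
allHist (suc n) = concatMap (λ h → map (λ S → (h , S)) (allSubsets n)) (allHist n)

-- Graph built by a history.  The newest vertex is labelled zero and the
-- older ones are shifted by suc (a relabelling, irrelevant up to ≅).
histAdj : ∀ {n} → Hist n → Fin n → Fin n → Bool
histAdj {suc n} (h , S) zero zero = false
histAdj {suc n} (h , S) zero (suc j) = lookup S j
histAdj {suc n} (h , S) (suc i) zero = lookup S i
histAdj {suc n} (h , S) (suc i) (suc j) = histAdj h i j

histGraph : ∀ {n} → Hist n → Graph n
histGraph h = mkGraph (histAdj h)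

-- Probability of one step: the new vertex, with m earlier vertices,
-- picks k = |S| uniformly in {0..m}, then S uniformly among (m C k) sets.
stepProb : ∀ m → Subset m → ℚ
stepProb m S = recipℕ (suc m * (m C ∣ S ∣))

histProb : ∀ {n} → Hist n → ℚ
histProb {zero} tt = 1ℚ
histProb {suc n} (h , S) = histProb h Q.* stepProb n S

sumℚ : List ℚ → ℚ
sumℚ = foldr _+_ 0ℚ

likelihood : IsoDec → ∀ {n} → Graph n → ℚ
likelihood dec {n} G =
  sumℚ (map (λ h → if does (dec (histGraph h) G) then histProb h else 0ℚ) (allHist n))

cycStep : ∀ {n} → Fin n → Fin n → Bool
cycStep {n} i j = (suc (toℕ i) ≡ᵇ toℕ j) ∨ ((suc (toℕ i) ≡ᵇ n) ∧ (toℕ j ≡ᵇ 0))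

cycleGraph : ∀ n → Graph n
cycleGraph n = mkGraph (λ i j → cycStep i j ∨ cycStep j i)

pathGraph : ∀ n → Graph n
pathGraph n = mkGraph (λ i j → (suc (toℕ i) ≡ᵇ toℕ j) ∨ (suc (toℕ j) ≡ᵇ toℕ i))

-- A history of n steps produces C_n exactly when its first n - 1 steps produce a
-- graph isomorphic to P_(n-1) and the last vertex is joined to the two ends of that
-- path: C_n is vertex-transitive, so the last vertex may be taken to be any vertex
-- of the cycle, and deleting it leaves a path.  The ends are intrinsic (they are the
-- vertices without two distinct neighbours), so for each such history exactly one
-- set of earlier vertices works for the last step; it has two elements, so it is
-- chosen with probability 1/(n · C(n-1,2)) whatever the history.

module Submission where

open import Defs
open import Data.Bool using (Bool; true; false; T; _∨_; if_then_else_)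
open import Data.Bool.Properties using (∨-comm; ∨-identityʳ; ∨-zeroʳ; ∧-zeroʳ; ∧-identityʳ)
open import Data.Empty using (⊥-elim)
open import Data.Fin using (Fin; zero; suc; toℕ; fromℕ<; fromℕ; inject₁)
import Data.Fin.Properties as Fin
open import Data.Fin.Permutation
  using (Permutation′; _⟨$⟩ʳ_; _⟨$⟩ˡ_; permutation; id; flip; _∘ₚ_; lift₀; remove; inverseˡ; inverseʳ; lift₀-remove)
open import Data.Fin.Subset using (Subset; ∣_∣)
open import Data.List using (List; []; _∷_; map; concatMap; _++_)
import Data.List.Properties as List
open import Data.Nat using (ℕ; zero; suc; _+_; _≤_; _<_; _*_; _∸_; _≡ᵇ_; s≤s; s≤s⁻¹; _<?_)
open import Data.Nat.Combinatorics using (_C_)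
import Data.Nat.Properties as ℕ
open import Data.Product using (_×_; _,_; ∃; ∃₂)
open import Data.Rational using (ℚ; 0ℚ)
import Data.Rational as Q
import Data.Rational.Properties as QP
open import Data.Sum using (_⊎_; inj₁; inj₂)
open import Data.Vec using ([]; _∷_; lookup; tabulate; tail)
open import Data.Vec.Properties using (lookup∘tabulate; tabulate∘lookup; tabulate-cong)
open import Function.Base using (_∘_)
open import Function.Bundles using (_⇔_; mk⇔; Equivalence)
open import Function.Properties.Equivalence using () renaming (trans to ⇔-trans; sym to ⇔-sym)
open import Relation.Nullary using (¬_; yes; no; does; contradiction)
open import Relation.Nullary.Decidable using (dec-true; dec-false; does-⇔)
open import Relation.Binary.PropositionalEquality
open import Algebra.Properties.CommutativeMonoid.Sum ℕ.+-0-commutativeMonoid using (sum; sum-permute)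

private
  variable
    m n : ℕ

≡ᵇ-true : ∀ {a b} → a ≡ b → (a ≡ᵇ b) ≡ true
≡ᵇ-true {a} {b} = dec-true (a ℕ.≟ b)

≡ᵇ-false : ∀ {a b} → a ≢ b → (a ≡ᵇ b) ≡ false
≡ᵇ-false {a} {b} = dec-false (a ℕ.≟ b)

≡ᵇ-sound : ∀ {a b} → (a ≡ᵇ b) ≡ true → a ≡ b
≡ᵇ-sound {a} {b} e = ℕ.≡ᵇ⇒≡ a b (subst T (sym e) _)

≡ᵇ-sym : ∀ a b → (a ≡ᵇ b) ≡ (b ≡ᵇ a)
≡ᵇ-sym a b = does-⇔ (mk⇔ sym sym) (a ℕ.≟ b) (b ℕ.≟ a)

toℕ-≡ᵇ-injective : (f : Fin n → Fin n) → (∀ {a b} → f a ≡ f b → a ≡ b) →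
  ∀ a b → (toℕ (f a) ≡ᵇ toℕ (f b)) ≡ (toℕ a ≡ᵇ toℕ b)
toℕ-≡ᵇ-injective f f-inj a b = does-⇔ (mk⇔ to from) (toℕ (f a) ℕ.≟ toℕ (f b)) (toℕ a ℕ.≟ toℕ b)
  where
  to : toℕ (f a) ≡ toℕ (f b) → toℕ a ≡ toℕ b
  to e = cong toℕ (f-inj (Fin.toℕ-injective e))
  from : toℕ a ≡ toℕ b → toℕ (f a) ≡ toℕ (f b)
  from e = cong (λ x → toℕ (f x)) (Fin.toℕ-injective e)

≡false-⇔⇒≡ : ∀ {a b} → (a ≡ false ⇔ b ≡ false) → a ≡ b
≡false-⇔⇒≡ {false} {false} _ = refl
≡false-⇔⇒≡ {false} {true}  a⇔b = sym (Equivalence.to a⇔b refl)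
≡false-⇔⇒≡ {true}  {false} a⇔b = Equivalence.from a⇔b refl
≡false-⇔⇒≡ {true}  {true}  _ = refl

permute-injective : (σ : Permutation′ n) → ∀ {a b} → σ ⟨$⟩ʳ a ≡ σ ⟨$⟩ʳ b → a ≡ b
permute-injective σ {a} {b} e = begin
  a                      ≡⟨ inverseˡ σ ⟨
  σ ⟨$⟩ˡ (σ ⟨$⟩ʳ a)      ≡⟨ cong (σ ⟨$⟩ˡ_) e ⟩
  σ ⟨$⟩ˡ (σ ⟨$⟩ʳ b)      ≡⟨ inverseˡ σ ⟩
  b                      ∎
  where open ≡-Reasoning

-- Counting subsets through sums makes permutation invariance available.
indicator : Bool → ℕ
indicator true  = 1
indicator false = 0

∣tabulate∣≡sum : (f : Fin n → Bool) → ∣ tabulate f ∣ ≡ sum (λ i → indicator (f i))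
∣tabulate∣≡sum {zero}  f = refl
∣tabulate∣≡sum {suc n} f with f zero
... | true  = cong suc (∣tabulate∣≡sum (λ i → f (suc i)))
... | false = ∣tabulate∣≡sum (λ i → f (suc i))

∣tabulate∘permute∣ : (f : Fin n → Bool) (π : Permutation′ n) →
  ∣ tabulate (λ v → f (π ⟨$⟩ˡ v)) ∣ ≡ ∣ tabulate f ∣
∣tabulate∘permute∣ f π = begin
  ∣ tabulate (λ v → f (π ⟨$⟩ˡ v)) ∣   ≡⟨ ∣tabulate∣≡sum (λ v → f (π ⟨$⟩ˡ v)) ⟩
  sum (λ v → indicator (f (π ⟨$⟩ˡ v))) ≡⟨ sum-permute (λ i → indicator (f i)) (flip π) ⟨
  sum (λ i → indicator (f i))          ≡⟨ ∣tabulate∣≡sum f ⟨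
  ∣ tabulate f ∣                       ∎
  where open ≡-Reasoning

∣tabulate-false∣ : ∀ n → ∣ tabulate {n} (λ _ → false) ∣ ≡ 0
∣tabulate-false∣ zero    = refl
∣tabulate-false∣ (suc n) = ∣tabulate-false∣ n

∣tabulate-toℕ≡ᵇ∣ : ∀ {n} t → t < n → ∣ tabulate {n} (λ i → toℕ i ≡ᵇ t) ∣ ≡ 1
∣tabulate-toℕ≡ᵇ∣ {suc n} zero    _   = cong suc (∣tabulate-false∣ n)
∣tabulate-toℕ≡ᵇ∣ {suc n} (suc t) t<n = ∣tabulate-toℕ≡ᵇ∣ t (s≤s⁻¹ t<n)

infix 4 _≅[_]_

_≅[_]_ : Graph n → Permutation′ n → Graph n → Set
G ≅[ σ ] H = ∀ i j → adj G (σ ⟨$⟩ʳ i) (σ ⟨$⟩ʳ j) ≡ adj H i j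

≅[]-trans : ∀ {G H K : Graph n} {σ ρ} → G ≅[ σ ] H → H ≅[ ρ ] K → G ≅[ ρ ∘ₚ σ ] K
≅[]-trans σ-iso ρ-iso i j = trans (σ-iso _ _) (ρ-iso i j)

TwoNeighbours : Graph n → Fin n → Set
TwoNeighbours {n} G v = ∃₂ λ (a b : Fin n) → a ≢ b × adj G v a ≡ true × adj G v b ≡ true

twoNeighbours-⇔ : ∀ {G H : Graph n} {σ} → G ≅[ σ ] H → ∀ u →
  TwoNeighbours H u ⇔ TwoNeighbours G (σ ⟨$⟩ʳ u)
twoNeighbours-⇔ {G = G} {H} {σ} iso u = mk⇔ to from
  where
  to : TwoNeighbours H u → TwoNeighbours G (σ ⟨$⟩ʳ u)
  to (a , b , a≢b , ua , ub) =
    σ ⟨$⟩ʳ a , σ ⟨$⟩ʳ b , (λ e → a≢b (permute-injective σ e)) , trans (iso u a) ua , trans (iso u b) ub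
  adj-from : ∀ a → adj G (σ ⟨$⟩ʳ u) a ≡ adj H u (σ ⟨$⟩ˡ a)
  adj-from a = trans (cong (adj G (σ ⟨$⟩ʳ u)) (sym (inverseʳ σ))) (iso u (σ ⟨$⟩ˡ a))
  from : TwoNeighbours G (σ ⟨$⟩ʳ u) → TwoNeighbours H u
  from (a , b , a≢b , ua , ub) =
    σ ⟨$⟩ˡ a , σ ⟨$⟩ˡ b , (λ e → a≢b (permute-injective (flip σ) e)) ,
    trans (sym (adj-from a)) ua , trans (sym (adj-from b)) ub

rotate : Fin (suc n) → Fin (suc n)
rotate {n} i with suc (toℕ i) <? suc n
... | yes i+1<n = fromℕ< i+1<n
... | no _      = zero

unrotate : Fin (suc n) → Fin (suc n)
unrotate {n} zero = fromℕ n
unrotate (suc j)  = inject₁ j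

toℕ-unrotate : (i : Fin (suc n)) → toℕ i ≡ suc m → toℕ (unrotate i) ≡ m
toℕ-unrotate (suc j) e = trans (Fin.toℕ-inject₁ j) (ℕ.suc-injective e)

toℕ-last : (i : Fin (suc n)) → ¬ (suc (toℕ i) < suc n) → toℕ i ≡ n
toℕ-last i i+1≮n = ℕ.≤-antisym (s≤s⁻¹ (Fin.toℕ<n i)) (s≤s⁻¹ (ℕ.≮⇒≥ i+1≮n))

rotate-unrotate : (i : Fin (suc n)) → rotate (unrotate i) ≡ i
rotate-unrotate {n} zero with suc (toℕ (fromℕ n)) <? suc n
... | yes n+1<n+1 = contradiction (subst (λ x → suc x < suc n) (Fin.toℕ-fromℕ n) n+1<n+1) (ℕ.<-irrefl refl)
... | no _        = refl
rotate-unrotate {n} (suc j) with suc (toℕ (inject₁ j)) <? suc n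
... | yes j+1<n = Fin.toℕ-injective (trans (Fin.toℕ-fromℕ< j+1<n) (cong suc (Fin.toℕ-inject₁ j)))
... | no j+1≮n  = contradiction (subst (λ x → suc x < suc n) (sym (Fin.toℕ-inject₁ j)) (s≤s (Fin.toℕ<n j))) j+1≮n

unrotate-rotate : (i : Fin (suc n)) → unrotate (rotate i) ≡ i
unrotate-rotate {n} i with suc (toℕ i) <? suc n
... | yes i+1<n = Fin.toℕ-injective (toℕ-unrotate (fromℕ< i+1<n) (Fin.toℕ-fromℕ< i+1<n))
... | no i+1≮n  = Fin.toℕ-injective (trans (Fin.toℕ-fromℕ n) (sym (toℕ-last i i+1≮n)))

rotation : Permutation′ (suc n)
rotation = permutation rotate unrotate rotate-unrotate unrotate-rotate

cycStep-rotate : (i j : Fin (suc n)) → cycStep i j ≡ (toℕ (rotate i) ≡ᵇ toℕ j)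
cycStep-rotate {n} i j with suc (toℕ i) <? suc n
... | yes i+1<n
  rewrite Fin.toℕ-fromℕ< i+1<n | ≡ᵇ-false {suc (toℕ i)} {suc n} (λ e → ℕ.<-irrefl e i+1<n) = ∨-identityʳ _
... | no i+1≮n
  rewrite toℕ-last i i+1≮n | ≡ᵇ-true {n} refl
        | ≡ᵇ-false {suc n} {toℕ j} (λ e → ℕ.<-irrefl (sym e) (Fin.toℕ<n j)) = ≡ᵇ-sym (toℕ j) 0

rotation-automorphism : cycleGraph (suc n) ≅[ rotation ] cycleGraph (suc n)
rotation-automorphism i j = cong₂ _∨_ (step i j) (step j i)
  where
  open ≡-Reasoning
  step : ∀ a b → cycStep (rotate a) (rotate b) ≡ cycStep a b
  step a b = begin
    cycStep (rotate a) (rotate b)              ≡⟨ cycStep-rotate (rotate a) (rotate b) ⟩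
    toℕ (rotate (rotate a)) ≡ᵇ toℕ (rotate b)  ≡⟨ toℕ-≡ᵇ-injective rotate (permute-injective rotation) (rotate a) b ⟩
    toℕ (rotate a) ≡ᵇ toℕ b                    ≡⟨ cycStep-rotate a b ⟨
    cycStep a b                                ∎

cycle-vertexTransitive : (c : Fin (suc n)) →
  ∃ λ ρ → cycleGraph (suc n) ≅[ ρ ] cycleGraph (suc n) × ρ ⟨$⟩ʳ zero ≡ c
cycle-vertexTransitive {n} c = rotations (toℕ c) c refl
  where
  Cₙ : Graph (suc n)
  Cₙ = cycleGraph (suc n)
  rotations : ∀ t c → toℕ c ≡ t → ∃ λ ρ → Cₙ ≅[ ρ ] Cₙ × ρ ⟨$⟩ʳ zero ≡ c
  rotations zero    c c≡0   = id , (λ _ _ → refl) , sym (Fin.toℕ-injective c≡0)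
  rotations (suc t) c c≡t+1 with rotations t (unrotate c) (toℕ-unrotate c c≡t+1)
  ... | ρ , ρ-aut , ρ0 = ρ ∘ₚ rotation , ≅[]-trans {G = Cₙ} {Cₙ} {Cₙ} {rotation} {ρ} rotation-automorphism ρ-aut ,
                         trans (cong rotate ρ0) (rotate-unrotate c)

-- Given π relating a graph to H with vertex zero deleted, the set that a new vertex
-- must be joined to for the extended graph to match H via lift₀ π.
zeroNeighbours : Graph (suc m) → Permutation′ m → Subset m
zeroNeighbours H π = tabulate (λ v → adj H zero (suc (π ⟨$⟩ˡ v)))

lookup-zeroNeighbours : (H : Graph (suc m)) (π : Permutation′ m) →
  ∀ j → lookup (zeroNeighbours H π) (π ⟨$⟩ʳ j) ≡ adj H zero (suc j)
lookup-zeroNeighbours H π j =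
  trans (lookup∘tabulate _ (π ⟨$⟩ʳ j)) (cong (λ u → adj H zero (suc u)) (inverseˡ π))

module _ (H : Graph (suc m)) (K : Graph m) (H-K : ∀ i j → adj H (suc i) (suc j) ≡ adj K i j) where

  extend-≅ : adj H zero zero ≡ false → (∀ j → adj H (suc j) zero ≡ adj H zero (suc j)) →
    ∀ {h : Hist m} {π} → histGraph h ≅[ π ] K → histGraph (h , zeroNeighbours H π) ≅[ lift₀ π ] H
  extend-≅ loopless symmetric         iso zero    zero    = sym loopless
  extend-≅ loopless symmetric {π = π} iso zero    (suc j) = lookup-zeroNeighbours H π j
  extend-≅ loopless symmetric {π = π} iso (suc i) zero    = trans (lookup-zeroNeighbours H π i) (sym (symmetric i))
  extend-≅ loopless symmetric         iso (suc i) (suc j) = trans (iso i j) (sym (H-K i j))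

  restrict-≅ : ∀ {h : Hist m} {S π} → histGraph (h , S) ≅[ π ] H → π ⟨$⟩ʳ zero ≡ zero →
    histGraph h ≅[ remove zero π ] K × S ≡ zeroNeighbours H (remove zero π)
  restrict-≅ {h = h} {S} {π} iso π0≡0 = iso′ , S≡
    where
    π′ : Permutation′ m
    π′ = remove zero π
    lift : ∀ i → suc (π′ ⟨$⟩ʳ i) ≡ π ⟨$⟩ʳ suc i
    lift i = lift₀-remove π π0≡0 (suc i)
    iso′ : histGraph h ≅[ π′ ] K
    iso′ i j = trans (cong₂ (histAdj (h , S)) (lift i) (lift j)) (trans (iso (suc i) (suc j)) (H-K i j))
    lookup-S : ∀ v → lookup S v ≡ adj H zero (suc (π′ ⟨$⟩ˡ v))
    lookup-S v = begin
      lookup S v                                                 ≡⟨ cong (lookup S) (inverseʳ π′) ⟨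
      histAdj (h , S) zero (suc (π′ ⟨$⟩ʳ (π′ ⟨$⟩ˡ v)))            ≡⟨ cong₂ (histAdj (h , S)) (sym π0≡0) (lift _) ⟩
      histAdj (h , S) (π ⟨$⟩ʳ zero) (π ⟨$⟩ʳ suc (π′ ⟨$⟩ˡ v))     ≡⟨ iso zero (suc _) ⟩
      adj H zero (suc (π′ ⟨$⟩ˡ v))                               ∎
      where open ≡-Reasoning
    S≡ : S ≡ zeroNeighbours H π′
    S≡ = trans (sym (tabulate∘lookup S)) (tabulate-cong lookup-S)

isPathEnd : Fin m → Bool
isPathEnd {m} u = (toℕ u ≡ᵇ 0) ∨ (suc (toℕ u) ≡ᵇ m)

cycle-sym : ∀ n (i j : Fin n) → adj (cycleGraph n) i j ≡ adj (cycleGraph n) j i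
cycle-sym n i j = ∨-comm (cycStep i j) (cycStep j i)

cycle-suc-suc : (i j : Fin m) → adj (cycleGraph (suc m)) (suc i) (suc j) ≡ adj (pathGraph m) i j
cycle-suc-suc {m} i j
  rewrite ∧-zeroʳ (suc (suc (toℕ i)) ≡ᵇ suc m) | ∧-zeroʳ (suc (suc (toℕ j)) ≡ᵇ suc m)
        | ∨-identityʳ (suc (toℕ i) ≡ᵇ toℕ j) | ∨-identityʳ (suc (toℕ j) ≡ᵇ toℕ i) = refl

cycle-zero-suc : (u : Fin m) → adj (cycleGraph (suc m)) zero (suc u) ≡ isPathEnd u
cycle-zero-suc {m} u
  rewrite ∧-zeroʳ (0 ≡ᵇ m) | ∨-identityʳ (0 ≡ᵇ toℕ u) | ∧-identityʳ (suc (toℕ u) ≡ᵇ m)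
        | ≡ᵇ-sym 0 (toℕ u) = refl

path-adj-suc : {u a : Fin m} → toℕ a ≡ suc (toℕ u) → adj (pathGraph m) u a ≡ true
path-adj-suc {u = u} {a} a≡u+1 = cong (_∨ (suc (toℕ a) ≡ᵇ toℕ u)) (≡ᵇ-true (sym a≡u+1))

path-adj-pred : {u a : Fin m} → suc (toℕ a) ≡ toℕ u → adj (pathGraph m) u a ≡ true
path-adj-pred {u = u} {a} a+1≡u =
  trans (cong ((suc (toℕ u) ≡ᵇ toℕ a) ∨_) (≡ᵇ-true a+1≡u)) (∨-zeroʳ _)

path-neighbour : {u a : Fin m} → adj (pathGraph m) u a ≡ true →
  toℕ a ≡ suc (toℕ u) ⊎ suc (toℕ a) ≡ toℕ u
path-neighbour {u = u} {a} ua with suc (toℕ u) ≡ᵇ toℕ a in u+1≡a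
... | true  = inj₁ (sym (≡ᵇ-sound u+1≡a))
... | false = inj₂ (≡ᵇ-sound ua)

path-twoNeighbours : {u : Fin m} → TwoNeighbours (pathGraph m) u →
  ∃₂ λ (a b : Fin m) → toℕ a ≡ suc (toℕ u) × suc (toℕ b) ≡ toℕ u
path-twoNeighbours (a , b , a≢b , ua , ub) with path-neighbour ua | path-neighbour ub
... | inj₁ a≡u+1 | inj₁ b≡u+1 = ⊥-elim (a≢b (Fin.toℕ-injective (trans a≡u+1 (sym b≡u+1))))
... | inj₁ a≡u+1 | inj₂ b+1≡u = a , b , a≡u+1 , b+1≡u
... | inj₂ a+1≡u | inj₁ b≡u+1 = b , a , b≡u+1 , a+1≡u
... | inj₂ a+1≡u | inj₂ b+1≡u = ⊥-elim (a≢b (Fin.toℕ-injective (ℕ.suc-injective (trans a+1≡u (sym b+1≡u)))))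

twoNeighbours⇒interior : {u : Fin m} → TwoNeighbours (pathGraph m) u → isPathEnd u ≡ false
twoNeighbours⇒interior two with path-twoNeighbours two
... | a , b , a≡u+1 , b+1≡u =
  cong₂ _∨_ (≡ᵇ-false λ u≡0 → ℕ.1+n≢0 (trans b+1≡u u≡0))
            (≡ᵇ-false λ u+1≡m → ℕ.<-irrefl (trans a≡u+1 u+1≡m) (Fin.toℕ<n a))

interior⇒twoNeighbours : {u : Fin m} → isPathEnd u ≡ false → TwoNeighbours (pathGraph m) u
interior⇒twoNeighbours {suc m} {suc w} w+1≢ᵇm =
  inject₁ w , suc (fromℕ< w+1<m) , a≢b ,
  path-adj-pred (cong suc (Fin.toℕ-inject₁ w)) , path-adj-suc (cong suc (Fin.toℕ-fromℕ< w+1<m))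
  where
  w+1<m : suc (toℕ w) < m
  w+1<m = ℕ.≤∧≢⇒< (Fin.toℕ<n w) λ w+1≡m → contradiction (trans (sym (≡ᵇ-true w+1≡m)) w+1≢ᵇm) λ ()
  a≢b : inject₁ w ≢ suc (fromℕ< w+1<m)
  a≢b e = ℕ.<⇒≢ (ℕ.m<n⇒m<1+n (ℕ.n<1+n (toℕ w)))
    (trans (sym (Fin.toℕ-inject₁ w)) (trans (cong toℕ e) (cong suc (Fin.toℕ-fromℕ< w+1<m))))

isPathEnd-false⇔twoNeighbours : (u : Fin m) → isPathEnd u ≡ false ⇔ TwoNeighbours (pathGraph m) u
isPathEnd-false⇔twoNeighbours u = mk⇔ interior⇒twoNeighbours twoNeighbours⇒interior

-- On Fin (2 + k), isPathEnd (suc w) computes to toℕ w ≡ᵇ k.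
∣tabulate-isPathEnd∣ : ∀ k → ∣ tabulate (isPathEnd {2 + k}) ∣ ≡ 2
∣tabulate-isPathEnd∣ k = cong suc (∣tabulate-toℕ≡ᵇ∣ k ℕ.≤-refl)

cycle-extends-path : {h : Hist (suc m)} {π : Permutation′ (suc m)} → histGraph h ≅[ π ] pathGraph (suc m) →
  histGraph (h , zeroNeighbours (cycleGraph (suc (suc m))) π) ≅[ lift₀ π ] cycleGraph (suc (suc m))
cycle-extends-path = extend-≅ (cycleGraph _) (pathGraph _) cycle-suc-suc refl (λ j → cycle-sym _ (suc j) zero)

-- Rotate the cycle so that the new vertex is matched with vertex zero, then delete it.
cycle-restricts-to-path : {h : Hist m} {S : Subset m} → histGraph (h , S) ≅ cycleGraph (suc m) →
  ∃ λ π → histGraph h ≅[ π ] pathGraph m × S ≡ zeroNeighbours (cycleGraph (suc m)) π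
cycle-restricts-to-path {m} {h} {S} (σ , σ-iso) with cycle-vertexTransitive (σ ⟨$⟩ˡ zero)
... | ρ , ρ-aut , ρ0≡σ⁻¹0 =
  remove zero (ρ ∘ₚ σ) ,
  restrict-≅ Cₙ (pathGraph m) cycle-suc-suc {h} {S} {ρ ∘ₚ σ}
    (≅[]-trans {G = histGraph (h , S)} {Cₙ} {Cₙ} {σ} {ρ} σ-iso ρ-aut)
    (trans (cong (σ ⟨$⟩ʳ_) ρ0≡σ⁻¹0) (inverseʳ σ))
  where
  Cₙ : Graph (suc m)
  Cₙ = cycleGraph (suc m)

cycle-zeroNeighbour-false⇔ : {G : Graph m} {π : Permutation′ m} → G ≅[ π ] pathGraph m → ∀ v →
  adj (cycleGraph (suc m)) zero (suc (π ⟨$⟩ˡ v)) ≡ false ⇔ TwoNeighbours G v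
cycle-zeroNeighbour-false⇔ {G = G} {π} iso v =
  subst₂ _⇔_ (cong (_≡ false) (sym (cycle-zero-suc u))) (cong (TwoNeighbours G) (inverseʳ π))
    (⇔-trans (isPathEnd-false⇔twoNeighbours u) (twoNeighbours-⇔ {G = G} {pathGraph _} {π} iso u))
  where
  u : Fin _
  u = π ⟨$⟩ˡ v

cycle-zeroNeighbours-unique : {G : Graph m} {π π′ : Permutation′ m} →
  G ≅[ π ] pathGraph m → G ≅[ π′ ] pathGraph m →
  zeroNeighbours (cycleGraph (suc m)) π ≡ zeroNeighbours (cycleGraph (suc m)) π′
cycle-zeroNeighbours-unique {G = G} {π} {π′} iso iso′ = tabulate-cong λ v →
  ≡false-⇔⇒≡ (⇔-trans (cycle-zeroNeighbour-false⇔ {G = G} {π} iso v)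
                      (⇔-sym (cycle-zeroNeighbour-false⇔ {G = G} {π′} iso′ v)))

∣cycle-zeroNeighbours∣ : ∀ k (π : Permutation′ (2 + k)) → ∣ zeroNeighbours (cycleGraph (3 + k)) π ∣ ≡ 2
∣cycle-zeroNeighbours∣ k π = begin
  ∣ zeroNeighbours Cₙ π ∣                     ≡⟨ ∣tabulate∘permute∣ (λ u → adj Cₙ zero (suc u)) π ⟩
  ∣ tabulate (λ u → adj Cₙ zero (suc u)) ∣    ≡⟨ cong ∣_∣ (tabulate-cong (cycle-zero-suc {2 + k})) ⟩
  ∣ tabulate (isPathEnd {2 + k}) ∣            ≡⟨ ∣tabulate-isPathEnd∣ k ⟩
  2                                           ∎
  where
  open ≡-Reasoning
  Cₙ : Graph (3 + k)
  Cₙ = cycleGraph (3 + k)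

sumℚ-++ : ∀ xs ys → sumℚ (xs ++ ys) ≡ sumℚ xs Q.+ sumℚ ys
sumℚ-++ []       ys = sym (QP.+-identityˡ _)
sumℚ-++ (x ∷ xs) ys = trans (cong (x Q.+_) (sumℚ-++ xs ys)) (sym (QP.+-assoc x _ _))

sumℚ-concatMap : ∀ {A B : Set} (f : B → ℚ) (g : A → List B) xs →
  sumℚ (map f (concatMap g xs)) ≡ sumℚ (map (λ x → sumℚ (map f (g x))) xs)
sumℚ-concatMap f g []       = refl
sumℚ-concatMap f g (x ∷ xs) = begin
  sumℚ (map f (g x ++ concatMap g xs))
    ≡⟨ cong sumℚ (List.map-++ f (g x) (concatMap g xs)) ⟩
  sumℚ (map f (g x) ++ map f (concatMap g xs))
    ≡⟨ sumℚ-++ (map f (g x)) _ ⟩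
  sumℚ (map f (g x)) Q.+ sumℚ (map f (concatMap g xs))
    ≡⟨ cong (sumℚ (map f (g x)) Q.+_) (sumℚ-concatMap f g xs) ⟩
  sumℚ (map f (g x)) Q.+ sumℚ (map (λ x → sumℚ (map f (g x))) xs) ∎
  where open ≡-Reasoning

sumℚ-map-*ʳ : ∀ {A : Set} (f : A → ℚ) r xs → sumℚ (map (λ x → f x Q.* r) xs) ≡ sumℚ (map f xs) Q.* r
sumℚ-map-*ʳ f r []       = sym (QP.*-zeroˡ r)
sumℚ-map-*ʳ f r (x ∷ xs) = trans (cong (f x Q.* r Q.+_) (sumℚ-map-*ʳ f r xs)) (sym (QP.*-distribʳ-+ r (f x) _))

sumℚ-map-zero : ∀ {A : Set} (f : A → ℚ) xs → (∀ x → f x ≡ 0ℚ) → sumℚ (map f xs) ≡ 0ℚ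
sumℚ-map-zero f []       f≡0 = refl
sumℚ-map-zero f (x ∷ xs) f≡0 rewrite f≡0 x | sumℚ-map-zero f xs f≡0 = refl

sumℚ-allSubsets-single : ∀ m (f : Subset m → ℚ) S → (∀ T → T ≢ S → f T ≡ 0ℚ) →
  sumℚ (map f (allSubsets m)) ≡ f S
sumℚ-allSubsets-single zero    f []      _    = QP.+-identityʳ _
sumℚ-allSubsets-single (suc m) f (b ∷ S) f≡0 =
  trans (sumℚ-concatMap f extensions (allSubsets m))
        (trans (sumℚ-allSubsets-single m f′ S f′≡0) (f′-at b f≡0))
  where
  extensions : Subset m → List (Subset (suc m))
  extensions T = (true ∷ T) ∷ (false ∷ T) ∷ []
  f′ : Subset m → ℚ
  f′ T = sumℚ (map f (extensions T))
  f′≡0 : ∀ T → T ≢ S → f′ T ≡ 0ℚ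
  f′≡0 T T≢S rewrite f≡0 (true ∷ T) (T≢S ∘ cong tail) | f≡0 (false ∷ T) (T≢S ∘ cong tail) = refl
  f′-at : ∀ b → (∀ T → T ≢ b ∷ S → f T ≡ 0ℚ) → f′ S ≡ f (b ∷ S)
  f′-at true  f≡0 rewrite f≡0 (false ∷ S) (λ ()) =
    trans (cong (f (true ∷ S) Q.+_) (QP.+-identityʳ 0ℚ)) (QP.+-identityʳ _)
  f′-at false f≡0 rewrite f≡0 (true ∷ S) (λ ()) = trans (QP.+-identityˡ _) (QP.+-identityʳ _)

weight : IsoDec → Graph n → Hist n → ℚ
weight dec G h = if does (dec (histGraph h) G) then histProb h else 0ℚ

weight-≅ : (dec : IsoDec) {G : Graph n} {h : Hist n} → histGraph h ≅ G → weight dec G h ≡ histProb h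
weight-≅ dec {G} {h} iso = cong (if_then histProb h else 0ℚ) (dec-true (dec (histGraph h) G) iso)

weight-≇ : (dec : IsoDec) {G : Graph n} {h : Hist n} → ¬ histGraph h ≅ G → weight dec G h ≡ 0ℚ
weight-≇ dec {G} {h} ¬iso = cong (if_then histProb h else 0ℚ) (dec-false (dec (histGraph h) G) ¬iso)

likelihood-lastStep : (dec : IsoDec) (G : Graph (suc m)) (H : Graph m) (r : ℚ) →
  (∀ h → sumℚ (map (λ S → weight dec G (h , S)) (allSubsets m)) ≡ weight dec H h Q.* r) →
  likelihood dec G ≡ likelihood dec H Q.* r
likelihood-lastStep {m} dec G H r step = begin
  sumℚ (map (weight dec G) (concatMap (λ h → map (h ,_) (allSubsets m)) (allHist m)))
    ≡⟨ sumℚ-concatMap (weight dec G) (λ h → map (h ,_) (allSubsets m)) (allHist m) ⟩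
  sumℚ (map (λ h → sumℚ (map (weight dec G) (map (h ,_) (allSubsets m)))) (allHist m))
    ≡⟨ cong sumℚ (List.map-cong (λ h → trans (cong sumℚ (sym (List.map-∘ (allSubsets m)))) (step h)) (allHist m)) ⟩
  sumℚ (map (λ h → weight dec H h Q.* r) (allHist m))
    ≡⟨ sumℚ-map-*ʳ (weight dec H) r (allHist m) ⟩
  sumℚ (map (weight dec H) (allHist m)) Q.* r ∎
  where open ≡-Reasoning

cycle-lastStep : (dec : IsoDec) (k : ℕ) (h : Hist (2 + k)) →
  sumℚ (map (λ S → weight dec (cycleGraph (3 + k)) (h , S)) (allSubsets (2 + k)))
    ≡ weight dec (pathGraph (2 + k)) h Q.* recipℕ ((3 + k) * ((2 + k) C 2))
cycle-lastStep dec k h with dec (histGraph h) (pathGraph (2 + k))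
... | yes (τ , τ-iso) = begin
  sumℚ (map (λ S → weight dec (cycleGraph (3 + k)) (h , S)) (allSubsets (2 + k)))
    ≡⟨ sumℚ-allSubsets-single (2 + k) _ S₀ others-vanish ⟩
  weight dec (cycleGraph (3 + k)) (h , S₀)
    ≡⟨ weight-≅ dec (lift₀ τ , cycle-extends-path τ-iso) ⟩
  histProb h Q.* recipℕ ((3 + k) * ((2 + k) C ∣ S₀ ∣))
    ≡⟨ cong (λ s → histProb h Q.* recipℕ ((3 + k) * ((2 + k) C s))) (∣cycle-zeroNeighbours∣ k τ) ⟩
  histProb h Q.* recipℕ ((3 + k) * ((2 + k) C 2)) ∎
  where
  open ≡-Reasoning
  S₀ : Subset (2 + k)
  S₀ = zeroNeighbours (cycleGraph (3 + k)) τ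
  attaching-set : ∀ {T} → histGraph (h , T) ≅ cycleGraph (3 + k) → T ≡ S₀
  attaching-set iso with cycle-restricts-to-path iso
  ... | π , π-iso , T≡ = trans T≡ (cycle-zeroNeighbours-unique {G = histGraph h} {π} {τ} π-iso τ-iso)
  others-vanish : ∀ T → T ≢ S₀ → weight dec (cycleGraph (3 + k)) (h , T) ≡ 0ℚ
  others-vanish T T≢S₀ = weight-≇ dec (T≢S₀ ∘ attaching-set)
... | no ¬path = begin
  sumℚ (map (λ S → weight dec (cycleGraph (3 + k)) (h , S)) (allSubsets (2 + k)))
    ≡⟨ sumℚ-map-zero _ (allSubsets (2 + k)) (λ S → weight-≇ dec (¬path ∘ restricted-iso)) ⟩
  0ℚ
    ≡⟨ QP.*-zeroˡ (recipℕ ((3 + k) * ((2 + k) C 2))) ⟨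
  0ℚ Q.* recipℕ ((3 + k) * ((2 + k) C 2)) ∎
  where
  open ≡-Reasoning
  restricted-iso : ∀ {S} → histGraph (h , S) ≅ cycleGraph (3 + k) → histGraph h ≅ pathGraph (2 + k)
  restricted-iso iso with cycle-restricts-to-path iso
  ... | π , π-iso , _ = π , π-iso

mainTheorem7 : (dec : IsoDec) (n : ℕ) → 3 ≤ n →
    likelihood dec (cycleGraph n)
      ≡ likelihood dec (pathGraph (n ∸ 1)) Q.* recipℕ (n * ((n ∸ 1) C 2))
mainTheorem7 dec (suc (suc (suc k))) _ =
  likelihood-lastStep dec (cycleGraph (3 + k)) (pathGraph (2 + k)) _ (cycle-lastStep dec k)
mainTheorem7 dec (suc zero)       (s≤s ())
mainTheorem7 dec (suc (suc zero)) (s≤s (s≤s ()))
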